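{- For each natural number $n\geq2$, let $V_n=\{a_1,\dots,a_{n-1}\}$ be an alphabet of $n-1$ pairwise different letters and $L_{3,n}=\{a_1a_2\cdots a_{n-1}\}$. Then $L_{3,n}\in\mathrm{SLT}_2\setminus\mathrm{REG}_n^Z$ for every $n\geq2$.
   Context: For $k\geq1$, a language $L$ over an alphabet $V$ is strictly locally $k$-testable (family $\mathrm{SLT}_k$) if there are sets $B,I,E\subseteq V^k$ and a finite set $F$ of words of length at most $k-1$ such that $L$ consists of the words of $F$ together with exactly those words $a_1a_2\cdots a_n$ ($n\geq k$, $a_i\in V$) for which $a_1\cdots a_k\in B$, $a_{j+1}\cdots a_{j+k}\in I$ for every $j$ with $1\leq j\leq n-k-1$, and $a_{n-k+1}\cdots a_n\in E$. $\mathrm{REG}_n^Z$ is the family of regular languages accepted by some deterministic finite automaton (with total transition function) with at most $n$ states. -}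

module Defs where

open import Data.Nat using (ℕ; _≤_; _<_; _∸_; suc)
open import Data.Fin using (Fin)
open import Data.Bool using (Bool; true)
open import Data.List using (List; length; take; drop; foldl; allFin)
open import Data.Product using (Σ; _×_; ∃-syntax)
open import Data.Sum using (_⊎_)
open import Function.Bundles using (_⇔_)
open import Relation.Binary.PropositionalEquality using (_≡_)

Word : ℕ → Set
Word m = List (Fin m)

Language : ℕ → Set₁
Language m = Word m → Set

-- the length-k factor a_{j+1} ... a_{j+k} of a word (0-indexed start j)
factor : {m : ℕ} → (k j : ℕ) → Word m → Word m
factor k j w = take k (drop j w)

-- Subsets of V^k are represented as predicates on words; they are only ever
-- applied to words of length k.  F : predicate on words, only words of
-- length ≤ k-1 count (such a set is automatically finite).
record SLTData (m k : ℕ) : Set₁ where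
  field
    B I E : Word m → Set
    F     : Word m → Set

SLTAccepts : {m k : ℕ} → SLTData m k → Word m → Set
SLTAccepts {m} {k} D w =
  (length w < k × F w)
  ⊎ (k ≤ length w
     × B (factor k 0 w)
     × (∀ j → 1 ≤ j → j ≤ length w ∸ k ∸ 1 → I (factor k j w))
     × E (drop (length w ∸ k) w))
  where open SLTData D

SLT : {m : ℕ} → ℕ → Language m → Set₁
SLT {m} k L = Σ (SLTData m k) λ D → ∀ w → L w ⇔ SLTAccepts D w

record DFA (m s : ℕ) : Set where
  field
    δ      : Fin s → Fin m → Fin s
    q₀     : Fin s
    accept : Fin s → Bool

DFAAccepts : {m s : ℕ} → DFA m s → Word m → Set
DFAAccepts A w = accept (foldl δ q₀ w) ≡ true
  where open DFA A

REGZ : {m : ℕ} → ℕ → Language m → Set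
REGZ {m} n L = ∃[ s ] (s ≤ n × Σ (DFA m s) λ A → ∀ w → L w ⇔ DFAAccepts A w)

-- V_n = {a_1,…,a_{n-1}} ≅ Fin (n ∸ 1);  L_{3,n} = { a_1 a_2 ⋯ a_{n-1} }
L3 : (n : ℕ) → Language (n ∸ 1)
L3 n w = w ≡ allFin (n ∸ 1)

-- A word over Fin (k+1) equals allFin (k+1) exactly when it starts with the letter 0, each
-- letter is followed by its successor, and it ends with the letter k; all three are
-- conditions on length-two factors, so the language is strictly locally 2-testable.
-- A DFA accepting only w sends the length w + 2 prefixes of w ++ [ c ] to pairwise
-- distinct states: if the prefixes of lengths a < b reached the same state, the prefix of
-- length b followed by drop a w would be accepted as well, yet it is longer than w.
module Submission where

open import Defs
open import Data.Nat using (ℕ; _≤_; _∸_; zero; suc; _+_; _<_; z≤n; s≤s; s≤s⁻¹; _≟_)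
open import Data.Nat.Properties
  using (suc-injective; +-suc; +-identityʳ; +-comm; +-monoˡ-<; m+[n∸m]≡n; m∸n≤m;
         ≤-trans; <-irrefl; ≤∧≢⇒<; <⇒≤pred; pred[m∸n]≡m∸[1+n]; ≰⇒>; <⇒≱; m≤n⇒m⊓n≡m)
open import Data.Fin as Fin using (Fin; toℕ; inject₁)
open import Data.Fin.Properties using (toℕ-injective; toℕ-inject₁; toℕ<n; pigeonhole)
open import Data.List using (List; []; _∷_; _++_; take; drop; length; foldl; tabulate; allFin)
open import Data.List.Properties
  using (foldl-++; take++drop≡id; length-take; length-drop; length-++; length-tabulate)
open import Data.List.Relation.Unary.Linked using (Linked; []; [-]; _∷_)
open import Data.Product using (_×_; _,_)
open import Data.Sum using (inj₁; inj₂)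
open import Data.Empty using (⊥)
open import Function.Bundles using (_⇔_; mk⇔; Equivalence)
open import Level using (0ℓ)
open import Relation.Binary.Core using (Rel; _⇒_)
open import Relation.Binary.PropositionalEquality
open import Relation.Nullary using (¬_; yes; no)

module _ {A : Set} where

  Adjacent : Rel A 0ℓ → List A → Set
  Adjacent R (x ∷ y ∷ []) = R x y
  Adjacent R _            = ⊥

  Adjacent-map : ∀ {R S : Rel A 0ℓ} → R ⇒ S → ∀ xs → Adjacent R xs → Adjacent S xs
  Adjacent-map R⇒S (_ ∷ _ ∷ []) Rxy = R⇒S Rxy

  linked⇒adjacent-factors : ∀ {R : Rel A 0ℓ} {xs} → Linked R xs →
                            ∀ j → 2 + j ≤ length xs → Adjacent R (take 2 (drop j xs))
  linked⇒adjacent-factors (Rxy ∷ _)   zero    _         = Rxy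
  linked⇒adjacent-factors (_ ∷ Rys)   (suc j) (s≤s 2+j≤) = linked⇒adjacent-factors Rys j 2+j≤
  linked⇒adjacent-factors [-]         (suc j) (s≤s ())

  adjacent-factors⇒linked : ∀ {R : Rel A 0ℓ} xs →
                            (∀ j → 2 + j ≤ length xs → Adjacent R (take 2 (drop j xs))) → Linked R xs
  adjacent-factors⇒linked []           _ = []
  adjacent-factors⇒linked (_ ∷ [])     _ = [-]
  adjacent-factors⇒linked (_ ∷ y ∷ ys) h =
    h 0 (s≤s (s≤s z≤n)) ∷ adjacent-factors⇒linked (y ∷ ys) (λ j le → h (suc j) (s≤s le))

  take-last-factor : ∀ (x y : A) r → take 2 (drop (length r) (x ∷ y ∷ r)) ≡ drop (length r) (x ∷ y ∷ r)
  take-last-factor x y []      = refl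
  take-last-factor x y (z ∷ r) = take-last-factor y z r

  length-take-≤ : ∀ n (xs : List A) → n ≤ length xs → length (take n xs) ≡ n
  length-take-≤ n xs n≤ = trans (length-take n xs) (m≤n⇒m⊓n≡m n≤)

  take-++ˡ : ∀ n (xs ys : List A) → n ≤ length xs → take n (xs ++ ys) ≡ take n xs
  take-++ˡ zero    xs       ys _         = refl
  take-++ˡ (suc n) (x ∷ xs) ys (s≤s n≤) = cong (x ∷_) (take-++ˡ n xs ys n≤)

module _ {m : ℕ} (Rᵇ R Rᵉ : Rel (Fin m) 0ℓ) (F : Word m → Set) where

  adjacencySLT : SLTData m 2
  adjacencySLT = record { B = Adjacent Rᵇ ; I = Adjacent R ; E = Adjacent Rᵉ ; F = F }

  linked⇒SLTAccepts : ∀ {x y r} → Rᵇ x y → Linked R (x ∷ y ∷ r) →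
                      Adjacent Rᵉ (drop (length r) (x ∷ y ∷ r)) → SLTAccepts adjacencySLT (x ∷ y ∷ r)
  linked⇒SLTAccepts {x} {y} {r} Rᵇxy linked end =
    inj₂ (s≤s (s≤s z≤n) , Rᵇxy , inner , end)
    where
    inner : ∀ j → 1 ≤ j → j ≤ length r ∸ 1 → Adjacent R (factor 2 j (x ∷ y ∷ r))
    inner j _ j≤ = linked⇒adjacent-factors linked j (s≤s (s≤s (≤-trans j≤ (m∸n≤m (length r) 1))))

  SLTAccepts⇒linked : (Rᵇ ⇒ R) → (Rᵉ ⇒ R) → ∀ {x y r} → SLTAccepts adjacencySLT (x ∷ y ∷ r) →
                      Rᵇ x y × Linked R (x ∷ y ∷ r) × Adjacent Rᵉ (drop (length r) (x ∷ y ∷ r))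
  SLTAccepts⇒linked Rᵇ⇒R Rᵉ⇒R {x} {y} {r} (inj₂ (_ , Rᵇxy , inner , end)) =
    Rᵇxy , adjacent-factors⇒linked (x ∷ y ∷ r) factor-adjacent , end
    where
    factor-adjacent : ∀ j → 2 + j ≤ 2 + length r → Adjacent R (factor 2 j (x ∷ y ∷ r))
    factor-adjacent zero    _ = Rᵇ⇒R Rᵇxy
    factor-adjacent (suc j) (s≤s (s≤s 1+j≤)) with suc j ≟ length r
    ... | yes 1+j≡ = subst (λ i → Adjacent R (factor 2 i (x ∷ y ∷ r))) (sym 1+j≡)
                       (subst (Adjacent R) (sym (take-last-factor x y r))
                              (Adjacent-map Rᵉ⇒R (drop (length r) (x ∷ y ∷ r)) end))
    ... | no  1+j≢ = inner (suc j) (s≤s z≤n)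
                       (subst (suc j ≤_) (pred[m∸n]≡m∸[1+n] (length r) 0) (<⇒≤pred (≤∧≢⇒< 1+j≤ 1+j≢)))
  SLTAccepts⇒linked _ _ (inj₁ (s≤s (s≤s ()) , _))

module _ {m : ℕ} where

  Succ : Rel (Fin m) 0ℓ
  Succ x y = toℕ y ≡ suc (toℕ x)

  Start : Rel (Fin m) 0ℓ
  Start x y = toℕ x ≡ 0 × Succ x y

  End : ℕ → Rel (Fin m) 0ℓ
  End k x y = Succ x y × toℕ y ≡ k

  linked-succ-tabulate : ∀ {n} (f : Fin (suc n) → Fin m) →
                         (∀ i → Succ (f (inject₁ i)) (f (Fin.suc i))) → Linked Succ (tabulate f)
  linked-succ-tabulate {zero}  f _ = [-]
  linked-succ-tabulate {suc n} f h =
    h Fin.zero ∷ linked-succ-tabulate (λ i → f (Fin.suc i)) (λ i → h (Fin.suc i))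

  linked-succ-unique : ∀ {x x′ xs ys} → Linked Succ (x ∷ xs) → Linked Succ (x′ ∷ ys) →
                       toℕ x ≡ toℕ x′ → length xs ≡ length ys → x ∷ xs ≡ x′ ∷ ys
  linked-succ-unique [-]         [-]           x≡x′ _   = cong (_∷ []) (toℕ-injective x≡x′)
  linked-succ-unique (Sxy ∷ Sys) (Sx′y′ ∷ Sys′) x≡x′ len =
    cong₂ _∷_ (toℕ-injective x≡x′)
              (linked-succ-unique Sys Sys′ (trans Sxy (trans (cong suc x≡x′) (sym Sx′y′))) (suc-injective len))
  linked-succ-unique [-] (_ ∷ _) _ ()
  linked-succ-unique (_ ∷ _) [-] _ ()

  linked-succ-last-factor : ∀ k {x y r} → Linked Succ (x ∷ y ∷ r) →
                            Adjacent (End k) (drop (length r) (x ∷ y ∷ r)) ⇔ suc (length r + toℕ x) ≡ k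
  linked-succ-last-factor k (Sxy ∷ [-]) =
    mk⇔ (λ { (_ , y≡k) → trans (sym Sxy) y≡k }) (λ e → Sxy , trans Sxy e)
  linked-succ-last-factor k {x} {y} {z ∷ r} (Sxy ∷ Sys) =
    mk⇔ (λ end → trans (sym shift) (Equivalence.to rest end))
        (λ e → Equivalence.from rest (trans shift e))
    where
    rest : Adjacent (End k) (drop (length r) (y ∷ z ∷ r)) ⇔ suc (length r + toℕ y) ≡ k
    rest = linked-succ-last-factor k Sys
    shift : suc (length r + toℕ y) ≡ suc (suc (length r + toℕ x))
    shift = cong suc (trans (cong (length r +_) Sxy) (+-suc (length r) (toℕ x)))

linked-succ-allFin : ∀ n → Linked Succ (allFin (suc n))
linked-succ-allFin n = linked-succ-tabulate (λ i → i) (λ i → cong suc (sym (toℕ-inject₁ i)))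

-- F only matters for n = 2, where the word a₁ is shorter than the window.
L3-SLTData : ∀ k → SLTData (suc k) 2
L3-SLTData k = adjacencySLT Start Succ (End k) (_≡ allFin (suc k))

allFin-SLTAccepts : ∀ k → SLTAccepts (L3-SLTData k) (allFin (suc k))
allFin-SLTAccepts zero    = inj₁ (s≤s (s≤s z≤n) , refl)
allFin-SLTAccepts (suc k) =
  linked⇒SLTAccepts Start Succ (End (suc k)) (_≡ allFin (suc (suc k)))
    (refl , refl) (linked-succ-allFin (suc k))
    (Equivalence.from (linked-succ-last-factor (suc k) (linked-succ-allFin (suc k)))
                      (cong suc (trans (+-identityʳ _) (length-tabulate _))))

SLTAccepts⇒allFin : ∀ k w → SLTAccepts (L3-SLTData k) w → w ≡ allFin (suc k)
SLTAccepts⇒allFin k w           (inj₁ (_ , w≡))   = w≡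
SLTAccepts⇒allFin k []          (inj₂ (() , _))
SLTAccepts⇒allFin k (_ ∷ [])    (inj₂ (s≤s () , _))
SLTAccepts⇒allFin k (x ∷ y ∷ r) accepts
  with (x≡0 , _) , linked , end ← SLTAccepts⇒linked Start Succ (End k) (_≡ allFin (suc k))
        (λ (_ , Sxy) → Sxy) (λ (Sxy , _) → Sxy) accepts =
  linked-succ-unique linked (linked-succ-allFin k) x≡0 length≡
  where
  open ≡-Reasoning
  length≡ : suc (length r) ≡ length (tabulate {n = k} Fin.suc)
  length≡ = begin
    suc (length r)            ≡⟨ cong suc (+-identityʳ (length r)) ⟨
    suc (length r + 0)        ≡⟨ cong (λ t → suc (length r + t)) x≡0 ⟨
    suc (length r + toℕ x)    ≡⟨ Equivalence.to (linked-succ-last-factor k linked) end ⟩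
    k                         ≡⟨ length-tabulate {n = k} Fin.suc ⟨
    length (tabulate {n = k} Fin.suc) ∎

L3-SLT : ∀ k → SLT {suc k} 2 (L3 (suc (suc k)))
L3-SLT k = L3-SLTData k , λ w → mk⇔ (λ { refl → allFin-SLTAccepts k }) (SLTAccepts⇒allFin k w)

singleton-DFA-states : ∀ {m s} (c : Fin m) (w : Word m) (A : DFA m s) →
                       (∀ u → u ≡ w ⇔ DFAAccepts A u) → suc (length w) < s
singleton-DFA-states {s = s} c w A accepts = ≰⇒> few-states⇒⊥
  where
  open DFA A
  open ≡-Reasoning

  w⁺ : Word _
  w⁺ = w ++ c ∷ []

  length-w⁺ : length w⁺ ≡ suc (length w)
  length-w⁺ = trans (length-++ w) (+-comm (length w) 1)

  state : Fin (2 + length w) → Fin _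
  state i = foldl δ q₀ (take (toℕ i) w⁺)

  collision⇒⊥ : ∀ i j → toℕ i < toℕ j → state i ≡ state j → ⊥
  collision⇒⊥ i j i<j same =
    <-irrefl refl (subst₂ _<_ (m+[n∸m]≡n a≤) length-u (+-monoˡ-< (length w ∸ a) i<j))
    where
    a = toℕ i
    b = toℕ j
    b≤ : b ≤ suc (length w)
    b≤ = s≤s⁻¹ (toℕ<n j)
    a≤ : a ≤ length w
    a≤ = s≤s⁻¹ (≤-trans i<j b≤)
    u : Word _
    u = take b w⁺ ++ drop a w
    run-u : foldl δ q₀ u ≡ foldl δ q₀ w
    run-u = begin
      foldl δ q₀ (take b w⁺ ++ drop a w) ≡⟨ foldl-++ δ q₀ (take b w⁺) (drop a w) ⟩
      foldl δ (state j) (drop a w)       ≡⟨ cong (λ q → foldl δ q (drop a w)) same ⟨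
      foldl δ (state i) (drop a w)       ≡⟨ foldl-++ δ q₀ (take a w⁺) (drop a w) ⟨
      foldl δ q₀ (take a w⁺ ++ drop a w) ≡⟨ cong (λ v → foldl δ q₀ (v ++ drop a w))
                                                  (take-++ˡ a w (c ∷ []) a≤) ⟩
      foldl δ q₀ (take a w ++ drop a w)  ≡⟨ cong (foldl δ q₀) (take++drop≡id a w) ⟩
      foldl δ q₀ w                       ∎
    u≡w : u ≡ w
    u≡w = Equivalence.from (accepts u) (trans (cong accept run-u) (Equivalence.to (accepts w) refl))
    length-u : b + (length w ∸ a) ≡ length w
    length-u = begin
      b + (length w ∸ a)                     ≡⟨ cong₂ _+_ length-prefix (length-drop a w) ⟨
      length (take b w⁺) + length (drop a w) ≡⟨ length-++ (take b w⁺) ⟨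
      length u                               ≡⟨ cong length u≡w ⟩
      length w                               ∎
      where
      length-prefix : length (take b w⁺) ≡ b
      length-prefix = length-take-≤ b w⁺ (subst (b ≤_) (sym length-w⁺) b≤)

  few-states⇒⊥ : ¬ s ≤ suc (length w)
  few-states⇒⊥ s≤ with i , j , i<j , same ← pigeonhole (s≤s s≤) state = collision⇒⊥ i j i<j same

lemma3 : (n : ℕ) → 2 ≤ n → SLT {n ∸ 1} 2 (L3 n) × ¬ REGZ {n ∸ 1} n (L3 n)
lemma3 (suc (suc k)) _ = L3-SLT k , λ (s , s≤n , A , accepts) →
  <⇒≱ (singleton-DFA-states Fin.zero (allFin (suc k)) A accepts)
      (subst (λ l → s ≤ suc l) (sym (length-tabulate {n = suc k} (λ i → i))) s≤n)
lemma3 (suc zero) (s≤s ())
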